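{- Let $\mathbb{K}$ be a field, $n\geqslant 1$ and $M\geqslant n+1$ integers, and let $x_0,x_1,\ldots,x_M$ be points of $\mathrm{PG}_M(\mathbb{K})$ in general position. Put $\Sigma_i=x_0\oplus\cdots\oplus x_i$ and $\pi_i=x_1\oplus\cdots\oplus x_i$ for $i=1,\ldots,M$. For $i=3,\ldots,M$ let $y_i$ be a point of the line $x_{i-1}\oplus x_i$ distinct from $x_{i-1}$ and $x_i$. Let $L$ be a finite set of lines of the plane $\Sigma_2$, none equal to $\pi_2$, which meet $\pi_2$ in pairwise distinct points of $\pi_2\setminus\{x_2\}$; label them $\ell_{(1)},\ldots,\ell_{(|L|)}$ and put $p_{(i)}=\ell_{(i)}\cap\pi_2$. For every ordered subset $J$ of $\{1,\ldots,|L|\}$ with $2\leqslant |J|\leqslant M-1$, writing $J=(\ldots,b,a)$, define recursively $$p_J=(x_{|J|+1}\oplus p_{J\setminus\{a\}})\cap(y_{|J|+1}\oplus p_{J\setminus\{b\}}).$$ Then the set $\{p_J : J \text{ an ordered subset of } \{1,\ldots,|L|\},\ |J|=n\}$ is contained in an $|L|^{n}$ grid of $\pi_{n+1}$ (regarded as the projective space $\mathrm{PG}_n(\mathbb{K})$).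
   Context: For non-intersecting subspaces $x,y$ of a projective space, $x\oplus y$ denotes the subspace they span. An ordered subset of $\{1,\ldots,|L|\}$ is a finite sequence $J=(a_1,\ldots,a_j)$ of pairwise distinct elements, with $|J|=j$; for an entry $a$ of $J$, $J\setminus\{a\}$ is obtained by deleting $a$ and keeping the order of the remaining entries; for $J=(i)$, $p_J=p_{(i)}$. An $N^{k}$ grid in a $k$-dimensional projective space $\mathrm{PG}_k(\mathbb{K})$ is a point set which, with respect to a suitable basis, has the form $\{\langle (a_1,\ldots,a_k,1)\rangle : a_i\in A_i\}$, where each $A_i$ is a subset of $\mathbb{K}$ of size $N$; here $\langle v\rangle$ denotes the projective point determined by the nonzero vector $v$. -}

module Defs where

open import Level using (Level; _⊔_)
open import Algebra.Bundles using (CommutativeRing)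
open import Data.Nat as ℕ using (ℕ; zero; suc)
open import Data.Fin using (Fin; zero; suc; toℕ; inject₁; fromℕ)
open import Data.List using (List)
open import Data.Product using (Σ; ∃; _×_)
open import Relation.Binary.PropositionalEquality using (_≡_)
open import Relation.Nullary using (¬_)

record Field (c ℓ : Level) : Set (Level.suc (c ⊔ ℓ)) where
  field
    commutativeRing : CommutativeRing c ℓ
  open CommutativeRing commutativeRing public
  field
    0≉1 : ¬ (0# ≈ 1#)
    inverse : ∀ x → ¬ (x ≈ 0#) → ∃ λ y → x * y ≈ 1#

module LinAlg {c ℓ : Level} (K : Field c ℓ) where
  open Field K using (Carrier; _≈_; 0#; 1#; _+_; _*_)

  Vect : ℕ → Set c
  Vect m = Fin m → Carrier

  sumFin : ∀ {r} → (Fin r → Carrier) → Carrier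
  sumFin {zero}  f = 0#
  sumFin {suc r} f = f zero + sumFin (λ i → f (suc i))

  lincomb : ∀ {m r} → (Fin r → Carrier) → (Fin r → Vect m) → Vect m
  lincomb cs us t = sumFin (λ i → cs i * us i t)

  _≈ᵥ_ : ∀ {m} → Vect m → Vect m → Set ℓ
  u ≈ᵥ v = ∀ t → u t ≈ v t

  -- a nonzero vector, i.e. a representative of a projective point
  IsPoint : ∀ {m} → Vect m → Set ℓ
  IsPoint v = ¬ (∀ t → v t ≈ 0#)

  -- v lies in the subspace spanned by us (i.e. the point ⟨v⟩ lies in
  -- the projective subspace  ⊕ of the points ⟨u_i⟩)
  InSpan : ∀ {m r} → (Fin r → Vect m) → Vect m → Set (c ⊔ ℓ)
  InSpan us v = ∃ λ cs → v ≈ᵥ lincomb cs us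

  LinIndep : ∀ {m r} → (Fin r → Vect m) → Set (c ⊔ ℓ)
  LinIndep {m} us = ∀ cs → (∀ t → lincomb cs us t ≈ 0#) → ∀ i → cs i ≈ 0#

  SameSpan : ∀ {m r s} → (Fin r → Vect m) → (Fin s → Vect m) → Set (c ⊔ ℓ)
  SameSpan us vs = (∀ i → InSpan vs (us i)) × (∀ j → InSpan us (vs j))

  [_] : ∀ {m} → Vect m → Fin 1 → Vect m
  [ u ] _ = u

  ⟨_,_⟩ : ∀ {m} → Vect m → Vect m → Fin 2 → Vect m
  ⟨ u , w ⟩ zero    = u
  ⟨ u , w ⟩ (suc _) = w

  SamePoint : ∀ {m} → Vect m → Vect m → Set (c ⊔ ℓ)
  SamePoint u v = InSpan [ v ] u

  -- The point with coordinates (a_1,…,a_n,1) w.r.t. the basis e_1,…,e_{n+1}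
  -- (e (inject₁ i) = e_{i+1} for i < n,  e (fromℕ n) = e_{n+1}).
  gridVec : ∀ {m n} → (Fin (suc n) → Vect m) → (Fin n → Carrier) → Vect m
  gridVec {n = n} e a t = lincomb a (λ i → e (inject₁ i)) t + e (fromℕ n) t

  -- S ⊆ an N^n grid of the projective subspace spanned by the n+1
  -- independent vectors πs (an n-dimensional projective space):
  -- there is a basis e of that subspace and subsets A_1,…,A_n ⊆ K,
  -- each of size N (given as injective maps Fin N → K), such that every
  -- point of S is ⟨ Σ a_i e_i + e_{n+1} ⟩ for some a_i ∈ A_i.
  InGrid : ∀ {m n} {p} (N : ℕ) (πs : Fin (suc n) → Vect m)
           (S : Vect m → Set p) → Set (c ⊔ ℓ ⊔ p)
  InGrid {m} {n} N πs S =
    Σ (Fin (suc n) → Vect m) λ e →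
      LinIndep e × (∀ i → InSpan πs (e i)) ×
      Σ (Fin n → Fin N → Carrier) λ A →
        (∀ i s t → A i s ≈ A i t → s ≡ t) ×
        (∀ v → S v → Σ (Fin n → Fin N) λ s → SamePoint v (gridVec e (λ i → A i (s i))))

  -- x_0,…,x_M (given as x : ℕ → K^{M+1}, only indices 0..M used) are points
  -- of PG_M(K) in general position: any M+1 (= all) of them are independent.
  GeneralPosition : ∀ M → (ℕ → Vect (suc M)) → Set (c ⊔ ℓ)
  GeneralPosition M x = LinIndep (λ (i : Fin (suc M)) → x (toℕ i))

  Σsp : ∀ {m} → (ℕ → Vect m) → (i : ℕ) → Fin (suc i) → Vect m
  Σsp x i t = x (toℕ t)

  πsp : ∀ {m} → (ℕ → Vect m) → (i : ℕ) → Fin i → Vect m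
  πsp x i t = x (suc (toℕ t))

module Submission where

open import Defs
open import Level using (_⊔_)
open import Function using (_∘_)
open import Data.Empty using (⊥-elim)
open import Data.Product using (Σ; _×_; _,_; proj₁; proj₂)
open import Data.Maybe using (Maybe; just; nothing)
open import Data.Nat as ℕ using (ℕ; zero; suc; _≤_; _<_; z≤n; s≤s)
import Data.Nat.Properties as ℕP
open import Data.Integer as ℤ using (ℤ; _⊖_; sign; ∣_∣)
import Data.Integer.Properties as ℤP
open import Data.Sign as Sign using (Sign)
open import Data.Fin as Fin using (Fin; zero; suc; toℕ; fromℕ<; inject₁; fromℕ; punchIn; lower₁)
open import Data.Fin.Properties
  using (toℕ-fromℕ<; toℕ-injective; toℕ≤pred[n]; punchInᵢ≢i; toℕ-inject₁; toℕ-fromℕ; toℕ<n; toℕ-cast; inject₁-lower₁)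
open import Data.List using (List; []; _∷_; _++_; length; lookup)
open import Data.List.Properties using (length-++; ++-assoc; ++-identityʳ)
open import Data.List.Relation.Unary.All using (All; _∷_)
import Data.List.Relation.Unary.All.Properties as All
open import Data.List.Relation.Unary.AllPairs using (_∷_)
open import Data.List.Relation.Unary.Unique.Propositional using (Unique)
open import Relation.Nullary using (¬_; yes; no; Dec)
open import Relation.Nullary.Decidable using (_×-dec_; decidable-stable)
open import Relation.Binary.Definitions using (Tri; tri<; tri≈; tri>)
open import Relation.Binary.PropositionalEquality as ≡ using (_≡_; _≢_)
import Algebra.Solver.Ring.AlmostCommutativeRing as ACR
import Algebra.Properties.Ring as RingProperties
import Algebra.Properties.Semiring.Mult.TCOptimised as SemiringMult

-- The proof computes the points p_J in coordinates.  For a sequence α let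
-- X(α) = Σ_u α_u x_u; general position makes X injective.  Normalising the
-- data, y_m = γ (x_{m-1} + slope_m x_m) with slope_m ≠ 0, and
-- p_(i) = A_i (x_1 + a_i x_2) with pairwise distinct labels a_i.  By
-- induction on |J| (lemma  meet, which intersects the two lines defining p_J
-- by comparing coordinates, and the bookkeeping lemma  pointCoords-step),
-- p_J is a multiple of X(pointCoords J), where for J = (j_0,…,j_{n-1})
--   pointCoords J = x_1 + Σ_{s<n} weight_s (a_{j_s} − a_{j_{s-1}}) x_{s+2}.
-- These coordinates depend affinely on the labels a_{j_s}: the images of the
-- unit label sequences together with x_1 form a basis e of π_{n+1} (the
-- weights are products of nonzero slopes), and in this basis p_J is the
-- grid point with coordinates (a_{j_0},…,a_{j_{n-1}}).

-- Ring normalisation in a field K.  Equations are solved by the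
-- standard ring solver with integer coefficients, interpreted in K
-- through the canonical ring homomorphism ℤ → K  (n ↦ n · 1).
module IntegerCoefficients {c ℓ} (K : Field c ℓ) where
  open Field K
  open RingProperties ring using (-1*x≈-x; -‿involutive; -‿anti-homo-+; -0#≈0#)
  open SemiringMult semiring using (1+×; ×-homo-+; ×1-homo-*) renaming (_×_ to _×′_)
  open import Relation.Binary.Reasoning.Setoid setoid

  ⟦_⟧ℕ : ℕ → Carrier
  ⟦ n ⟧ℕ = n ×′ 1#

  ⟦_⟧ℤ : ℤ → Carrier
  ⟦ ℤ.+ n ⟧ℤ      = ⟦ n ⟧ℕ
  ⟦ ℤ.-[1+ n ] ⟧ℤ = - ⟦ suc n ⟧ℕ

  private
    cancel-1 : ∀ a b → (1# + a) - (1# + b) ≈ a - b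
    cancel-1 a b = begin
      (1# + a) - (1# + b)       ≈⟨ +-congˡ (-‿anti-homo-+ 1# b) ⟩
      (1# + a) + (- b + - 1#)   ≈⟨ +-congʳ (+-comm 1# a) ⟩
      (a + 1#) + (- b + - 1#)   ≈⟨ +-assoc a 1# _ ⟩
      a + (1# + (- b + - 1#))   ≈⟨ +-congˡ (+-congˡ (+-comm (- b) (- 1#))) ⟩
      a + (1# + (- 1# + - b))   ≈⟨ +-congˡ (sym (+-assoc 1# (- 1#) (- b))) ⟩
      a + ((1# - 1#) + - b)     ≈⟨ +-congˡ (+-congʳ (-‿inverseʳ 1#)) ⟩
      a + (0# + - b)            ≈⟨ +-congˡ (+-identityˡ (- b)) ⟩
      a - b                     ∎

    ⊖-homo : ∀ m n → ⟦ m ⊖ n ⟧ℤ ≈ ⟦ m ⟧ℕ - ⟦ n ⟧ℕ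
    ⊖-homo m       zero    = sym (trans (+-congˡ -0#≈0#) (+-identityʳ _))
    ⊖-homo zero    (suc n) = sym (+-identityˡ _)
    ⊖-homo (suc m) (suc n) rewrite ℤP.[1+m]⊖[1+n]≡m⊖n m n = begin
      ⟦ m ⊖ n ⟧ℤ                    ≈⟨ ⊖-homo m n ⟩
      ⟦ m ⟧ℕ - ⟦ n ⟧ℕ               ≈⟨ cancel-1 ⟦ m ⟧ℕ ⟦ n ⟧ℕ ⟨
      (1# + ⟦ m ⟧ℕ) - (1# + ⟦ n ⟧ℕ)  ≈⟨ +-cong (1+× m 1#) (-‿cong (1+× n 1#)) ⟨
      ⟦ suc m ⟧ℕ - ⟦ suc n ⟧ℕ       ∎

    +-homo : ∀ i j → ⟦ i ℤ.+ j ⟧ℤ ≈ ⟦ i ⟧ℤ + ⟦ j ⟧ℤ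
    +-homo ℤ.-[1+ m ] ℤ.-[1+ n ] = begin
      - ⟦ suc (suc (m ℕ.+ n)) ⟧ℕ          ≡⟨ ≡.cong (λ k → - ⟦ suc k ⟧ℕ) (ℕP.+-suc m n) ⟨
      - ⟦ suc m ℕ.+ suc n ⟧ℕ              ≈⟨ -‿cong (×-homo-+ 1# (suc m) (suc n)) ⟩
      - (⟦ suc m ⟧ℕ + ⟦ suc n ⟧ℕ)          ≈⟨ -‿anti-homo-+ _ _ ⟩
      - ⟦ suc n ⟧ℕ + - ⟦ suc m ⟧ℕ          ≈⟨ +-comm _ _ ⟩
      - ⟦ suc m ⟧ℕ + - ⟦ suc n ⟧ℕ          ∎
    +-homo ℤ.-[1+ m ] (ℤ.+ n)    = trans (⊖-homo n (suc m)) (+-comm _ _)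
    +-homo (ℤ.+ m)    ℤ.-[1+ n ] = ⊖-homo m (suc n)
    +-homo (ℤ.+ m)    (ℤ.+ n)    = ×-homo-+ 1# m n

    neg-homo : ∀ i → ⟦ ℤ.- i ⟧ℤ ≈ - ⟦ i ⟧ℤ
    neg-homo ℤ.-[1+ n ]    = sym (-‿involutive _)
    neg-homo (ℤ.+ zero)    = sym -0#≈0#
    neg-homo (ℤ.+ suc n) = refl

    ⟦_⟧± : Sign → Carrier
    ⟦ Sign.+ ⟧± = 1#
    ⟦ Sign.- ⟧± = - 1#

    ◃-homo : ∀ s n → ⟦ s ℤ.◃ n ⟧ℤ ≈ ⟦ s ⟧± * ⟦ n ⟧ℕ
    ◃-homo s       zero    = sym (zeroʳ _)
    ◃-homo Sign.+ (suc n) = sym (*-identityˡ _)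
    ◃-homo Sign.- (suc n) = sym (-1*x≈-x _)

    sign-homo : ∀ s t → ⟦ s Sign.* t ⟧± ≈ ⟦ s ⟧± * ⟦ t ⟧±
    sign-homo Sign.+ t      = sym (*-identityˡ _)
    sign-homo Sign.- Sign.+ = sym (*-identityʳ _)
    sign-homo Sign.- Sign.- = sym (trans (-1*x≈-x _) (-‿involutive _))

    sign-abs : ∀ i → ⟦ i ⟧ℤ ≈ ⟦ sign i ⟧± * ⟦ ∣ i ∣ ⟧ℕ
    sign-abs (ℤ.+ n)      = sym (*-identityˡ _)
    sign-abs ℤ.-[1+ n ]   = sym (-1*x≈-x _)

    *-homo : ∀ i j → ⟦ i ℤ.* j ⟧ℤ ≈ ⟦ i ⟧ℤ * ⟦ j ⟧ℤ
    *-homo i j = begin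
      ⟦ i ℤ.* j ⟧ℤ
        ≈⟨ ◃-homo (sign i Sign.* sign j) (∣ i ∣ ℕ.* ∣ j ∣) ⟩
      ⟦ sign i Sign.* sign j ⟧± * ⟦ ∣ i ∣ ℕ.* ∣ j ∣ ⟧ℕ
        ≈⟨ *-cong (sign-homo (sign i) (sign j)) (×1-homo-* ∣ i ∣ ∣ j ∣) ⟩
      (⟦ sign i ⟧± * ⟦ sign j ⟧±) * (⟦ ∣ i ∣ ⟧ℕ * ⟦ ∣ j ∣ ⟧ℕ)
        ≈⟨ *-assoc _ _ _ ⟩
      ⟦ sign i ⟧± * (⟦ sign j ⟧± * (⟦ ∣ i ∣ ⟧ℕ * ⟦ ∣ j ∣ ⟧ℕ))
        ≈⟨ *-congˡ (trans (sym (*-assoc _ _ _)) (trans (*-congʳ (*-comm _ _)) (*-assoc _ _ _))) ⟩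
      ⟦ sign i ⟧± * (⟦ ∣ i ∣ ⟧ℕ * (⟦ sign j ⟧± * ⟦ ∣ j ∣ ⟧ℕ))
        ≈⟨ sym (*-assoc _ _ _) ⟩
      (⟦ sign i ⟧± * ⟦ ∣ i ∣ ⟧ℕ) * (⟦ sign j ⟧± * ⟦ ∣ j ∣ ⟧ℕ)
        ≈⟨ *-cong (sign-abs i) (sign-abs j) ⟨
      ⟦ i ⟧ℤ * ⟦ j ⟧ℤ ∎

    almostCommutativeRing : ACR.AlmostCommutativeRing c ℓ
    almostCommutativeRing = ACR.fromCommutativeRing commutativeRing

    homomorphism : ℤ.+-*-rawRing ACR.-Raw-AlmostCommutative⟶ almostCommutativeRing
    homomorphism = record
      { ⟦_⟧ = ⟦_⟧ℤ ; +-homo = +-homo ; *-homo = *-homo ; -‿homo = neg-homo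
      ; 0-homo = refl ; 1-homo = refl }

    coefficient≟ : ∀ i j → Maybe (⟦ i ⟧ℤ ≈ ⟦ j ⟧ℤ)
    coefficient≟ i j with i ℤ.≟ j
    ... | yes i≡j = just (reflexive (≡.cong ⟦_⟧ℤ i≡j))
    ... | no _    = nothing

  open import Algebra.Solver.Ring ℤ.+-*-rawRing almostCommutativeRing homomorphism coefficient≟ public
    using (solve; _:=_; _:+_; _:*_; _:-_; :-_; Polynomial; con)

  :0 :1 : ∀ {n} → Polynomial n
  :0 = con (ℤ.+ 0)
  :1 = con (ℤ.+ 1)

select : ∀ {a} {A : Set a} → ℕ → ℕ → A → A → A
select _       zero    v w = w
select zero    (suc n) v w = v
select (suc u) (suc n) v w = select u n v w

select-< : ∀ {a} {A : Set a} {u n} (v w : A) → u < n → select u n v w ≡ v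
select-< {u = zero}  {suc n} v w _         = ≡.refl
select-< {u = suc u} {suc n} v w (s≤s u<n) = select-< v w u<n

select-≥ : ∀ {a} {A : Set a} {u n} (v w : A) → n ≤ u → select u n v w ≡ w
select-≥ {n = zero}          v w _         = ≡.refl
select-≥ {u = suc u} {suc n} v w (s≤s n≤u) = select-≥ v w n≤u

select-preserves : ∀ {a p} {A : Set a} (P : A → Set p) {v w : A} → P v → P w →
                   ∀ u n → P (select u n v w)
select-preserves P pv pw _       zero    = pw
select-preserves P pv pw zero    (suc n) = pv
select-preserves P pv pw (suc u) (suc n) = select-preserves P pv pw u n

All-remove : ∀ {a p} {A : Set a} {P : A → Set p} (I : List A) {z} R →
             All P (I ++ z ∷ R) → All P (I ++ R)
All-remove I R all with All.++⁻ I all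
... | all-I , (_ ∷ all-R) = All.++⁺ all-I all-R

unique-remove : ∀ {a} {A : Set a} (I : List A) {z} R → Unique (I ++ z ∷ R) → Unique (I ++ R)
unique-remove []      R (_ ∷ uniq)     = uniq
unique-remove (h ∷ I) R (h∉ ∷ uniq) = All-remove I R h∉ ∷ unique-remove I R uniq

unique-init : ∀ {a} {A : Set a} (I : List A) {b a'} → Unique (I ++ b ∷ a' ∷ []) → Unique (I ++ b ∷ [])
unique-init I {b} {a'} uniq = ≡.subst Unique (++-identityʳ (I ++ b ∷ []))
  (unique-remove (I ++ b ∷ []) [] (≡.subst Unique (≡.sym (++-assoc I (b ∷ []) (a' ∷ []))) uniq))

unsnoc₂ : ∀ {a} {A : Set a} (J : List A) {j} → length J ≡ 2 ℕ.+ j →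
          Σ (List A) λ I → Σ A λ b → Σ A λ a' → J ≡ I ++ b ∷ a' ∷ [] × length I ≡ j
unsnoc₂ (b ∷ a' ∷ [])     {zero}  ≡.refl = [] , b , a' , ≡.refl , ≡.refl
unsnoc₂ (h ∷ h' ∷ h'' ∷ J) {suc j} len with unsnoc₂ (h' ∷ h'' ∷ J) (ℕP.suc-injective len)
... | I , b , a' , J≡ , length-I = h ∷ I , b , a' , ≡.cong (h ∷_) J≡ , ≡.cong suc length-I

choose : ∀ {a p q} {A : Set a} {P : ℕ → Set p} {Q : ℕ → A → Set q} →
         (∀ m → Dec (P m)) → A → (∀ m → P m → Σ A (Q m)) →
         Σ (ℕ → A) λ f → ∀ m → P m → Q m (f m)
choose {A = A} {P} {Q} P? default witness = pick , picked
  where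
  pickDec : ∀ m → Dec (P m) → A
  pickDec m (yes Pm) = proj₁ (witness m Pm)
  pickDec m (no _)   = default
  pick : ℕ → A
  pick m = pickDec m (P? m)
  picked : ∀ m → P m → Q m (pick m)
  picked m Pm with P? m
  ... | yes Pm' = proj₂ (witness m Pm')
  ... | no ¬Pm  = ⊥-elim (¬Pm Pm)

module Geometry {c ℓ} (K : Field c ℓ) where
  open Field K hiding (zero)
  open LinAlg K
  open IntegerCoefficients K
  open import Algebra.Properties.Ring ring using (x∙y⁻¹≈ε⇒x≈y; -1*x≈-x)
  open import Algebra.Properties.CommutativeMonoid.Sum +-commutativeMonoid
    using (sum; sum-cong-≋; ∑-distrib-+; sum-init-last; sum-replicate-zero; sum-remove)
  open import Algebra.Properties.Semiring.Sum semiring using (*-distribˡ-sum)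
  open import Relation.Binary.Reasoning.Setoid setoid

  cancel-nonzero : ∀ {u v} → ¬ (u ≈ 0#) → u * v ≈ 0# → v ≈ 0#
  cancel-nonzero {u} {v} u≉0 uv≈0 = begin
    v              ≈⟨ *-identityˡ v ⟨
    1# * v         ≈⟨ *-congʳ (proj₂ (inverse u u≉0)) ⟨
    (u * u⁻¹) * v  ≈⟨ solve 3 (λ u u⁻¹ v → (u :* u⁻¹) :* v := u⁻¹ :* (u :* v)) refl u u⁻¹ v ⟩
    u⁻¹ * (u * v)  ≈⟨ *-congˡ uv≈0 ⟩
    u⁻¹ * 0#       ≈⟨ zeroʳ u⁻¹ ⟩
    0#             ∎
    where u⁻¹ = proj₁ (inverse u u≉0)

  *-nonzero : ∀ {u v} → ¬ (u ≈ 0#) → ¬ (v ≈ 0#) → ¬ (u * v ≈ 0#)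
  *-nonzero u≉0 v≉0 uv≈0 = v≉0 (cancel-nonzero u≉0 uv≈0)

  -‿nonzero : ∀ {u} → ¬ (u ≈ 0#) → ¬ (- u ≈ 0#)
  -‿nonzero {u} u≉0 -u≈0 =
    u≉0 (trans (solve 1 (λ u → u := :- (:- u)) refl u) (trans (-‿cong -u≈0) (solve 0 (:- :0 := :0) refl)))

  sumFin≡sum : ∀ {r} (f : Fin r → Carrier) → sumFin f ≡ sum f
  sumFin≡sum {zero}  f = ≡.refl
  sumFin≡sum {suc r} f = ≡.cong (f zero +_) (sumFin≡sum (λ i → f (suc i)))

  sumFin-cong : ∀ {r} {f g : Fin r → Carrier} → (∀ i → f i ≈ g i) → sumFin f ≈ sumFin g
  sumFin-cong {f = f} {g} f≈g rewrite sumFin≡sum f | sumFin≡sum g = sum-cong-≋ f≈g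

  sumFin-+ : ∀ {r} (f g : Fin r → Carrier) → sumFin (λ i → f i + g i) ≈ sumFin f + sumFin g
  sumFin-+ f g rewrite sumFin≡sum (λ i → f i + g i) | sumFin≡sum f | sumFin≡sum g = ∑-distrib-+ f g

  sumFin-*ˡ : ∀ {r} a (f : Fin r → Carrier) → sumFin (λ i → a * f i) ≈ a * sumFin f
  sumFin-*ˡ a f rewrite sumFin≡sum (λ i → a * f i) | sumFin≡sum f = sym (*-distribˡ-sum a f)

  sumFin-zero : ∀ {r} (f : Fin r → Carrier) → (∀ i → f i ≈ 0#) → sumFin f ≈ 0#
  sumFin-zero {r} f f≈0 rewrite sumFin≡sum f = trans (sum-cong-≋ f≈0) (sum-replicate-zero r)

  sumFin-init-last : ∀ {r} (f : Fin (suc r) → Carrier) →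
                     sumFin f ≈ sumFin (λ i → f (inject₁ i)) + f (fromℕ r)
  sumFin-init-last f rewrite sumFin≡sum f | sumFin≡sum (λ i → f (inject₁ i)) = sum-init-last f

  sumFin-truncate : ∀ {r R} (g : ℕ → Carrier) → r ≤ R → (∀ t → r ≤ t → g t ≈ 0#) →
                    sumFin {R} (λ i → g (toℕ i)) ≈ sumFin {r} (λ i → g (toℕ i))
  sumFin-truncate {zero} {R}      g _         g≈0 = sumFin-zero {R} (λ i → g (toℕ i)) (λ i → g≈0 (toℕ i) z≤n)
  sumFin-truncate {suc r} {suc R} g (s≤s r≤R) g≈0 =
    +-congˡ (sumFin-truncate (λ t → g (suc t)) r≤R (λ t r≤t → g≈0 (suc t) (s≤s r≤t)))

  sumFin-single : ∀ {r} (f : Fin r → Carrier) j → (∀ i → i ≢ j → f i ≈ 0#) → sumFin f ≈ f j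
  sumFin-single {suc r} f j others≈0 rewrite sumFin≡sum f = begin
    sum f                                ≈⟨ sum-remove {i = j} f ⟩
    f j + sum (λ i → f (punchIn j i))    ≈⟨ +-congˡ rest≈0 ⟩
    f j + 0#                             ≈⟨ +-identityʳ (f j) ⟩
    f j                                  ∎
    where
    rest≈0 : sum (λ i → f (punchIn j i)) ≈ 0#
    rest≈0 = trans (reflexive (≡.sym (sumFin≡sum (λ i → f (punchIn j i)))))
                   (sumFin-zero _ (λ i → others≈0 _ (punchInᵢ≢i j i)))

  module _ {m r} (us : Fin r → Vect m) where

    lincomb-cong : ∀ {cs ds} → (∀ i → cs i ≈ ds i) → ∀ t → lincomb cs us t ≈ lincomb ds us t
    lincomb-cong cs≈ds t = sumFin-cong (λ i → *-congʳ (cs≈ds i))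

    lincomb-+ : ∀ cs ds t → lincomb (λ i → cs i + ds i) us t ≈ lincomb cs us t + lincomb ds us t
    lincomb-+ cs ds t = trans (sumFin-cong (λ i → distribʳ (us i t) (cs i) (ds i)))
                              (sumFin-+ (λ i → cs i * us i t) (λ i → ds i * us i t))

    lincomb-* : ∀ a cs t → lincomb (λ i → a * cs i) us t ≈ a * lincomb cs us t
    lincomb-* a cs t = trans (sumFin-cong (λ i → *-assoc a (cs i) (us i t)))
                             (sumFin-*ˡ a (λ i → cs i * us i t))

    lincomb-zero : ∀ cs → (∀ i → cs i ≈ 0#) → ∀ t → lincomb cs us t ≈ 0#
    lincomb-zero cs cs≈0 t = sumFin-zero _ (λ i → trans (*-congʳ (cs≈0 i)) (zeroˡ (us i t)))

    lincomb-single : ∀ cs j → (∀ i → i ≢ j → cs i ≈ 0#) → ∀ t → lincomb cs us t ≈ cs j * us j t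
    lincomb-single cs j others≈0 t =
      sumFin-single _ j (λ i i≢j → trans (*-congʳ (others≈0 i i≢j)) (zeroˡ (us i t)))

    lincomb-- : ∀ cs ds t → lincomb (λ i → cs i - ds i) us t ≈ lincomb cs us t - lincomb ds us t
    lincomb-- cs ds t = begin
      lincomb (λ i → cs i - ds i) us t                ≈⟨ lincomb-+ cs (λ i → - ds i) t ⟩
      lincomb cs us t + lincomb (λ i → - ds i) us t   ≈⟨ +-congˡ (lincomb-cong (λ i → -1*x≈-x (ds i)) t) ⟨
      lincomb cs us t + lincomb (λ i → - 1# * ds i) us t ≈⟨ +-congˡ (lincomb-* (- 1#) ds t) ⟩
      lincomb cs us t + - 1# * lincomb ds us t        ≈⟨ +-congˡ (-1*x≈-x _) ⟩
      lincomb cs us t - lincomb ds us t               ∎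

    lincomb-sum : ∀ {s} (q : Fin s → Carrier) (H : Fin s → Fin r → Carrier) t →
                  sumFin (λ j → q j * lincomb (H j) us t) ≈ lincomb (λ i → sumFin (λ j → q j * H j i)) us t
    lincomb-sum {zero}  q H t = sym (lincomb-zero (λ _ → 0#) (λ _ → refl) t)
    lincomb-sum {suc s} q H t = begin
      q zero * lincomb (H zero) us t + sumFin (λ j → q (suc j) * lincomb (H (suc j)) us t)
        ≈⟨ +-cong (sym (lincomb-* (q zero) (H zero) t)) (lincomb-sum (λ j → q (suc j)) (λ j → H (suc j)) t) ⟩
      lincomb (λ i → q zero * H zero i) us t + lincomb (λ i → sumFin (λ j → q (suc j) * H (suc j) i)) us t
        ≈⟨ lincomb-+ _ _ t ⟨
      lincomb (λ i → sumFin (λ j → q j * H j i)) us t ∎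

  δ : ℕ → ℕ → Carrier
  δ zero    zero    = 1#
  δ zero    (suc _) = 0#
  δ (suc _) zero    = 0#
  δ (suc i) (suc j) = δ i j

  δ-diag : ∀ i → δ i i ≡ 1#
  δ-diag zero    = ≡.refl
  δ-diag (suc i) = δ-diag i

  δ-off : ∀ {i j} → i ≢ j → δ i j ≡ 0#
  δ-off {zero}  {zero}  i≢j = ⊥-elim (i≢j ≡.refl)
  δ-off {zero}  {suc j} _   = ≡.refl
  δ-off {suc i} {zero}  _   = ≡.refl
  δ-off {suc i} {suc j} i≢j = δ-off (λ i≡j → i≢j (≡.cong suc i≡j))

  onLine : ∀ {m} {u w v : Vect m} → InSpan ⟨ u , w ⟩ v → ¬ SamePoint v w →
           Σ Carrier λ A → Σ Carrier λ r → ¬ (A ≈ 0#) × (∀ t → v t ≈ A * (u t + r * w t))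
  onLine {u = u} {w} {v} (cs , v≈) v≉w = A , B * A⁻¹ , A≉0 , normalForm
    where
    A = cs zero
    B = cs (suc zero)
    A≉0 : ¬ (A ≈ 0#)
    A≉0 A≈0 = v≉w ((λ _ → B) , λ t → trans (v≈ t)
      (trans (+-congʳ (trans (*-congʳ A≈0) (zeroˡ (u t)))) (+-identityˡ _)))
    A⁻¹ = proj₁ (inverse A A≉0)
    normalForm : ∀ t → v t ≈ A * (u t + (B * A⁻¹) * w t)
    normalForm t = begin
      v t                                ≈⟨ v≈ t ⟩
      A * u t + (B * w t + 0#)           ≈⟨ solve 4 (λ a b u w → a :* u :+ (b :* w :+ :0) := a :* u :+ (b :* :1) :* w) refl A B (u t) (w t) ⟩
      A * u t + (B * 1#) * w t           ≈⟨ +-congˡ (*-congʳ (*-congˡ (proj₂ (inverse A A≉0)))) ⟨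
      A * u t + (B * (A * A⁻¹)) * w t    ≈⟨ solve 5 (λ a a⁻¹ b u w → a :* u :+ (b :* (a :* a⁻¹)) :* w := a :* (u :+ (b :* a⁻¹) :* w)) refl A A⁻¹ B (u t) (w t) ⟩
      A * (u t + (B * A⁻¹) * w t)        ∎

  ratio-nonzero : ∀ {m} {u w v : Vect m} {A r} → (∀ t → v t ≈ A * (u t + r * w t)) →
                  ¬ SamePoint v u → ¬ (r ≈ 0#)
  ratio-nonzero {u = u} {w} {v} {A} {r} v≈ v≉u r≈0 = v≉u ((λ _ → A) , λ t → begin
    v t                     ≈⟨ v≈ t ⟩
    A * (u t + r * w t)     ≈⟨ *-congˡ (+-congˡ (trans (*-congʳ r≈0) (zeroˡ (w t)))) ⟩
    A * (u t + 0#)          ≈⟨ solve 2 (λ a u → a :* (u :+ :0) := a :* u :+ :0) refl A (u t) ⟩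
    A * u t + 0#            ∎)

  sameRatio⇒samePoint : ∀ {m} {u w v v' : Vect m} {A A' r r'} →
    (∀ t → v t ≈ A * (u t + r * w t)) → (∀ t → v' t ≈ A' * (u t + r' * w t)) →
    ¬ (A' ≈ 0#) → r ≈ r' → SamePoint v v'
  sameRatio⇒samePoint {u = u} {w} {v} {v'} {A} {A'} {r} {r'} v≈ v'≈ A'≉0 r≈r' =
    (λ _ → A * A'⁻¹) , λ t → begin
      v t                                      ≈⟨ v≈ t ⟩
      A * (u t + r * w t)                      ≈⟨ *-congˡ (+-congˡ (*-congʳ r≈r')) ⟩
      A * (u t + r' * w t)                     ≈⟨ *-identityˡ _ ⟨
      1# * (A * (u t + r' * w t))              ≈⟨ *-congʳ (proj₂ (inverse A' A'≉0)) ⟨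
      (A' * A'⁻¹) * (A * (u t + r' * w t))     ≈⟨ solve 6 (λ a' a'⁻¹ a u r w → (a' :* a'⁻¹) :* (a :* (u :+ r :* w)) := (a :* a'⁻¹) :* (a' :* (u :+ r :* w)) :+ :0) refl A' A'⁻¹ A (u t) r' (w t) ⟩
      (A * A'⁻¹) * (A' * (u t + r' * w t)) + 0# ≈⟨ +-congʳ (*-congˡ (v'≈ t)) ⟨
      (A * A'⁻¹) * v' t + 0#                   ∎
    where A'⁻¹ = proj₁ (inverse A' A'≉0)

  -- The lines through
  -- y_i = γ (x_{i-1} + slope_i x_i) introduce the weights
  --   weight_0 = 1,   weight_{s+1} = − slope_{s+3} weight_s,
  -- and a sequence q_0,…,q_{n-1} of labels gives the coordinate vector
  --   coords n q = x_1 + Σ_{s<n} weight_s (q_s − q_{s-1}) x_{s+2}     (q_{-1} = 0).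
  module Sequences (slope : ℕ → Carrier) where

    weight : ℕ → Carrier
    weight zero    = 1#
    weight (suc s) = - (slope (3 ℕ.+ s) * weight s)

    weight-nonzero : ∀ s → (∀ t → t < s → ¬ (slope (3 ℕ.+ t) ≈ 0#)) → ¬ (weight s ≈ 0#)
    weight-nonzero zero    _       = 0≉1 ∘ sym
    weight-nonzero (suc s) slope≉0 = -‿nonzero (*-nonzero (slope≉0 s ℕP.≤-refl)
      (weight-nonzero s (λ t t<s → slope≉0 t (ℕP.m≤n⇒m≤1+n t<s))))

    prev : (ℕ → Carrier) → ℕ → Carrier
    prev q zero    = 0#
    prev q (suc s) = q s

    steps : ℕ → (ℕ → Carrier) → ℕ → Carrier
    steps n q zero          = 0#
    steps n q (suc zero)    = 0#
    steps n q (suc (suc s)) = select s n (weight s) 0# * (q s - prev q s)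

    coords : ℕ → (ℕ → Carrier) → ℕ → Carrier
    coords n q u = steps n q u + δ 1 u

    coords-one : ∀ n q → coords n q 1 ≈ 1#
    coords-one n q = +-identityˡ 1#

    steps-beyond : ∀ n q u → 2 ℕ.+ n ≤ u → steps n q u ≈ 0#
    steps-beyond n q (suc (suc s)) (s≤s (s≤s n≤s))
      rewrite select-≥ (weight s) 0# n≤s = zeroˡ _

    coords-beyond : ∀ n q u → 2 ℕ.+ n ≤ u → coords n q u ≈ 0#
    coords-beyond n q (suc zero)    (s≤s ())
    coords-beyond n q (suc (suc s)) n+2≤u = trans (+-identityʳ _) (steps-beyond n q (2 ℕ.+ s) n+2≤u)

    steps-local : ∀ n {q q'} → (∀ s → s < n → q s ≈ q' s) → ∀ u → steps n q u ≈ steps n q' u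
    steps-local n q≈q' zero          = refl
    steps-local n q≈q' (suc zero)    = refl
    steps-local n {q} {q'} q≈q' (suc (suc s)) with s ℕ.<? n
    ... | yes s<n = *-congˡ (+-cong (q≈q' s s<n) (-‿cong (prev≈ s s<n)))
      where
      prev≈ : ∀ s → s < n → prev q s ≈ prev q' s
      prev≈ zero    _   = refl
      prev≈ (suc s) s<n = q≈q' s (ℕP.<-trans (ℕP.n<1+n s) s<n)
    ... | no s≮n rewrite select-≥ (weight s) 0# (ℕP.≮⇒≥ s≮n) = trans (zeroˡ _) (sym (zeroˡ _))

    steps-linear : ∀ {r} n (b : Fin r → Carrier) (Q : Fin r → ℕ → Carrier) u →
                   sumFin (λ i → b i * steps n (Q i) u) ≈ steps n (λ s → sumFin (λ i → b i * Q i s)) u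
    steps-linear n b Q zero          = sumFin-zero _ (λ i → zeroʳ (b i))
    steps-linear n b Q (suc zero)    = sumFin-zero _ (λ i → zeroʳ (b i))
    steps-linear n b Q (suc (suc s)) = begin
      sumFin (λ i → b i * (w * (Q i s - prev (Q i) s)))
        ≈⟨ sumFin-cong (λ i → solve 4 (λ b w q p → b :* (w :* (q :- p)) := w :* (b :* q) :+ (:- w) :* (b :* p)) refl (b i) w (Q i s) (prev (Q i) s)) ⟩
      sumFin (λ i → w * (b i * Q i s) + - w * (b i * prev (Q i) s))
        ≈⟨ sumFin-+ (λ i → w * (b i * Q i s)) (λ i → - w * (b i * prev (Q i) s)) ⟩
      sumFin (λ i → w * (b i * Q i s)) + sumFin (λ i → - w * (b i * prev (Q i) s))
        ≈⟨ +-cong (sumFin-*ˡ w (λ i → b i * Q i s)) (sumFin-*ˡ (- w) (λ i → b i * prev (Q i) s)) ⟩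
      w * Σ[bQ] s + - w * sumFin (λ i → b i * prev (Q i) s)
        ≈⟨ +-congˡ (*-congˡ (prev-sum s)) ⟩
      w * Σ[bQ] s + - w * prev Σ[bQ] s
        ≈⟨ solve 3 (λ w x y → w :* x :+ (:- w) :* y := w :* (x :- y)) refl w (Σ[bQ] s) (prev Σ[bQ] s) ⟩
      w * (Σ[bQ] s - prev Σ[bQ] s) ∎
      where
      w = select s n (weight s) 0#
      Σ[bQ] : ℕ → Carrier
      Σ[bQ] s = sumFin (λ i → b i * Q i s)
      prev-sum : ∀ s → sumFin (λ i → b i * prev (Q i) s) ≈ prev Σ[bQ] s
      prev-sum zero    = sumFin-zero _ (λ i → zeroʳ (b i))
      prev-sum (suc s) = refl

    steps-injective : ∀ n q → (∀ s → s < n → ¬ (weight s ≈ 0#)) →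
                      (∀ s → s < n → steps n q (2 ℕ.+ s) ≈ 0#) → ∀ s → s < n → q s ≈ 0#
    steps-injective n q weight≉0 steps≈0 s s<n = trans (x∙y⁻¹≈ε⇒x≈y _ _ difference≈0) (previous≈0 s s<n)
      where
      difference≈0 : q s - prev q s ≈ 0#
      difference≈0 = cancel-nonzero (weight≉0 s s<n)
        (trans (*-congʳ (reflexive (≡.sym (select-< (weight s) 0# s<n)))) (steps≈0 s s<n))
      previous≈0 : ∀ s → s < n → prev q s ≈ 0#
      previous≈0 zero    _   = refl
      previous≈0 (suc s) s<n = steps-injective n q weight≉0 steps≈0 s (ℕP.<-trans (ℕP.n<1+n s) s<n)

    -- The labels of an ordered subset J = (j_0, j_1, …) of {1,…,k} are the
    -- values a_{j_0}, a_{j_1}, … (followed by zeros); the point p_J will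
    -- have coordinates  pointCoords J.
    module Labelling {k} (a : Fin k → Carrier) where

      labels : List (Fin k) → ℕ → Carrier
      labels []      _       = 0#
      labels (j ∷ J) zero    = a j
      labels (j ∷ J) (suc s) = labels J s

      pointCoords : List (Fin k) → ℕ → Carrier
      pointCoords J = coords (length J) (labels J)

      labels-++ˡ : ∀ J R {s} → s < length J → labels (J ++ R) s ≡ labels J s
      labels-++ˡ (j ∷ J) R {zero}  _         = ≡.refl
      labels-++ˡ (j ∷ J) R {suc s} (s≤s s<J) = labels-++ˡ J R s<J

      labels-last : ∀ J z R → labels (J ++ z ∷ R) (length J) ≡ a z
      labels-last []      z R = ≡.refl
      labels-last (j ∷ J) z R = labels-last J z R

      labels-lookup : ∀ J j → labels J (toℕ j) ≡ a (lookup J j)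
      labels-lookup (i ∷ J) zero    = ≡.refl
      labels-lookup (i ∷ J) (suc j) = labels-lookup J j

      prev-labels-++ : ∀ J R {s} → s ≤ length J → prev (labels (J ++ R)) s ≡ prev (labels J) s
      prev-labels-++ J R {zero}  _   = ≡.refl
      prev-labels-++ J R {suc s} s<J = labels-++ˡ J R s<J

      length-snoc : ∀ (J : List (Fin k)) z → length (J ++ z ∷ []) ≡ suc (length J)
      length-snoc J z = ≡.trans (length-++ J {z ∷ []}) (ℕP.+-comm (length J) 1)

      pointCoords-snoc-old : ∀ J z {n} → length J ≡ n → ∀ u → u ≢ 2 ℕ.+ n →
                             pointCoords (J ++ z ∷ []) u ≈ pointCoords J u
      pointCoords-snoc-old J z ≡.refl zero          _  = refl
      pointCoords-snoc-old J z ≡.refl (suc zero)    _  = refl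
      pointCoords-snoc-old J z ≡.refl (suc (suc s)) u≢ = +-congʳ (step (ℕP.<-cmp s (length J)))
        where
        Jz = J ++ z ∷ []
        length-Jz = length-snoc J z
        step : Tri (s < length J) (s ≡ length J) (length J < s) →
               select s (length Jz) (weight s) 0# * (labels Jz s - prev (labels Jz) s)
                 ≈ select s (length J) (weight s) 0# * (labels J s - prev (labels J) s)
        step (tri< s<J _ _) = *-cong
          (reflexive (≡.trans (select-< (weight s) 0# (≡.subst (s <_) (≡.sym length-Jz) (ℕP.m<n⇒m<1+n s<J)))
                              (≡.sym (select-< (weight s) 0# s<J))))
          (reflexive (≡.cong₂ _-_ (labels-++ˡ J (z ∷ []) s<J) (prev-labels-++ J (z ∷ []) (ℕP.<⇒≤ s<J))))
        step (tri≈ _ s≡J _) = ⊥-elim (u≢ (≡.cong (2 ℕ.+_) s≡J))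
        step (tri> _ _ J<s) = begin
          select s (length Jz) (weight s) 0# * dJz ≡⟨ ≡.cong (_* dJz) (select-≥ (weight s) 0# (≡.subst (_≤ s) (≡.sym length-Jz) J<s)) ⟩
          0# * dJz                                ≈⟨ zeroˡ dJz ⟩
          0#                                      ≈⟨ zeroˡ dJ ⟨
          0# * dJ                                 ≡⟨ ≡.cong (_* dJ) (select-≥ (weight s) 0# (ℕP.<⇒≤ J<s)) ⟨
          select s (length J) (weight s) 0# * dJ  ∎
          where
          dJz = labels Jz s - prev (labels Jz) s
          dJ  = labels J s - prev (labels J) s

      pointCoords-snoc-new : ∀ J z {n} → length J ≡ n →
        pointCoords (J ++ z ∷ []) (2 ℕ.+ n) ≈ weight n * (a z - prev (labels J) n)
      pointCoords-snoc-new J z ≡.refl = trans (+-identityʳ _) (*-cong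
        (reflexive (select-< (weight (length J)) 0# (≡.subst (length J <_) (≡.sym (length-snoc J z)) (ℕP.n<1+n (length J)))))
        (reflexive (≡.cong₂ _-_ (labels-last J z []) (prev-labels-++ J (z ∷ []) (ℕP.≤-refl {length J})))))

      -- the coordinates of p_{(…,b,a)} from those of p_{(…,b)} and p_{(…,a)}
      pointCoords-step : ∀ I b a' u → let L = length I in
        pointCoords (I ++ b ∷ a' ∷ []) u ≈
          pointCoords (I ++ b ∷ []) u
          + (slope (3 ℕ.+ L) * (pointCoords (I ++ b ∷ []) (2 ℕ.+ L) - pointCoords (I ++ a' ∷ []) (2 ℕ.+ L)))
            * δ (3 ℕ.+ L) u
      pointCoords-step I b a' u rewrite ≡.sym (++-assoc I (b ∷ []) (a' ∷ [])) with u ℕ.≟ 3 ℕ.+ length I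
      ... | no u≢ = begin
        pointCoords (Ib ++ a' ∷ []) u    ≈⟨ pointCoords-snoc-old Ib a' (length-snoc I b) u u≢ ⟩
        pointCoords Ib u                 ≈⟨ solve 2 (λ p t → p := p :+ t :* :0) refl (pointCoords Ib u) t₀ ⟩
        pointCoords Ib u + t₀ * 0#       ≈⟨ +-congˡ (*-congˡ (reflexive (δ-off (u≢ ∘ ≡.sym)))) ⟨
        pointCoords Ib u + t₀ * δ (3 ℕ.+ length I) u ∎
        where
        Ib = I ++ b ∷ []
        t₀ = slope (3 ℕ.+ length I) * (pointCoords Ib (2 ℕ.+ length I) - pointCoords (I ++ a' ∷ []) (2 ℕ.+ length I))
      ... | yes ≡.refl = begin
        pointCoords (Ib ++ a' ∷ []) (3 ℕ.+ L)
          ≈⟨ pointCoords-snoc-new Ib a' (length-snoc I b) ⟩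
        weight (suc L) * (a a' - prev (labels Ib) (suc L))
          ≡⟨ ≡.cong (λ l → weight (suc L) * (a a' - l)) (labels-last I b []) ⟩
        - (slope (3 ℕ.+ L) * weight L) * (a a' - a b)
          ≈⟨ solve 5 (λ c w a b q → :- (c :* w) :* (a :- b) := :0 :+ (c :* (w :* (b :- q) :- w :* (a :- q))) :* :1)
                     refl (slope (3 ℕ.+ L)) (weight L) (a a') (a b) (prev (labels I) L) ⟩
        0# + (slope (3 ℕ.+ L) * (weight L * (a b - q) - weight L * (a a' - q))) * 1#
          ≈⟨ +-cong (coords-beyond (length Ib) (labels Ib) (3 ℕ.+ L) (ℕP.≤-reflexive (≡.cong (2 ℕ.+_) (length-snoc I b))))
                    (*-cong (*-congˡ (+-cong (pointCoords-snoc-new I b ≡.refl) (-‿cong (pointCoords-snoc-new I a' ≡.refl))))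
                            (reflexive (δ-diag (3 ℕ.+ L)))) ⟨
        pointCoords Ib (3 ℕ.+ L)
          + (slope (3 ℕ.+ L) * (pointCoords Ib (2 ℕ.+ L) - pointCoords (I ++ a' ∷ []) (2 ℕ.+ L))) * δ (3 ℕ.+ L) (3 ℕ.+ L) ∎
        where
        L = length I
        Ib = I ++ b ∷ []
        q = prev (labels I) L

  -- The coordinate equations behind  meet  (see below): if the two
  -- coordinate vectors
  --   c₀ δ_{s+3} + c₁ μ P   and   d₀ γ (δ_{s+2} + c δ_{s+3}) + d₁ ν Q
  -- agree at the indices 1, …, s+3, where P_1 = Q_1 = 1 and
  -- P_{s+3} = Q_{s+3} = 0, then  c₀ = c₁ μ · c (P_{s+2} − Q_{s+2}).
  -- (Index 1 gives c₁ μ = d₁ ν, index s+2 gives d₀ γ, index s+3 gives c₀.)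
  coefficient-at-meet : ∀ s (P Q : ℕ → Carrier) (c₀ c₁ μ d₀ d₁ ν γ c : Carrier) →
    P 1 ≈ 1# → Q 1 ≈ 1# → P (3 ℕ.+ s) ≈ 0# → Q (3 ℕ.+ s) ≈ 0# →
    (∀ u → 1 ≤ u → u ≤ 3 ℕ.+ s →
      c₀ * δ (3 ℕ.+ s) u + c₁ * (μ * P u) ≈ d₀ * (γ * (δ (2 ℕ.+ s) u + c * δ (3 ℕ.+ s) u)) + d₁ * (ν * Q u)) →
    c₀ ≈ (c₁ * μ) * (c * (P (2 ℕ.+ s) - Q (2 ℕ.+ s)))
  coefficient-at-meet s P Q c₀ c₁ μ d₀ d₁ ν γ c P₁≈1 Q₁≈1 Pₘ≈0 Qₘ≈0 agree = begin
    c₀                                              ≈⟨ at-m ⟩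
    (d₀ * γ) * c                                    ≈⟨ solve 3 (λ a e c → a :* c := ((a :+ e) :- e) :* c) refl (d₀ * γ) ((d₁ * ν) * Q m₁) c ⟩
    ((d₀ * γ + (d₁ * ν) * Q m₁) - (d₁ * ν) * Q m₁) * c ≈⟨ *-congʳ (+-cong at-m₁ (-‿cong (*-congʳ at-1))) ⟨
    (λ₀ * P m₁ - λ₀ * Q m₁) * c                     ≈⟨ solve 4 (λ l p q c → (l :* p :- l :* q) :* c := l :* (c :* (p :- q))) refl λ₀ (P m₁) (Q m₁) c ⟩
    λ₀ * (c * (P m₁ - Q m₁))                        ∎
    where
    m  = 3 ℕ.+ s
    m₁ = 2 ℕ.+ s
    λ₀ = c₁ * μ

    at-1 : λ₀ ≈ d₁ * ν
    at-1 = begin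
      c₁ * μ                                   ≈⟨ solve 3 (λ a b u → b :* u := a :* :0 :+ b :* (u :* :1)) refl c₀ c₁ μ ⟩
      c₀ * 0# + c₁ * (μ * 1#)                  ≈⟨ +-congˡ (*-congˡ (*-congˡ P₁≈1)) ⟨
      c₀ * 0# + c₁ * (μ * P 1)                 ≈⟨ agree 1 ℕP.≤-refl (s≤s z≤n) ⟩
      d₀ * (γ * (0# + c * 0#)) + d₁ * (ν * Q 1) ≈⟨ +-congˡ (*-congˡ (*-congˡ Q₁≈1)) ⟩
      d₀ * (γ * (0# + c * 0#)) + d₁ * (ν * 1#) ≈⟨ solve 5 (λ a b g c n → a :* (g :* (:0 :+ c :* :0)) :+ b :* (n :* :1) := b :* n) refl d₀ d₁ γ c ν ⟩
      d₁ * ν                                   ∎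

    at-m₁ : λ₀ * P m₁ ≈ d₀ * γ + (d₁ * ν) * Q m₁
    at-m₁ = begin
      λ₀ * P m₁                                ≈⟨ solve 4 (λ a b u p → (b :* u) :* p := a :* :0 :+ b :* (u :* p)) refl c₀ c₁ μ (P m₁) ⟩
      c₀ * 0# + c₁ * (μ * P m₁)                ≈⟨ +-congʳ (*-congˡ (reflexive (δ-off {m} {m₁} ℕP.1+n≢n))) ⟨
      c₀ * δ m m₁ + c₁ * (μ * P m₁)            ≈⟨ agree m₁ (s≤s z≤n) (ℕP.n≤1+n m₁) ⟩
      d₀ * (γ * (δ m₁ m₁ + c * δ m m₁)) + d₁ * (ν * Q m₁)
        ≈⟨ +-congʳ (*-congˡ (*-congˡ (+-cong (reflexive (δ-diag m₁)) (*-congˡ (reflexive (δ-off {m} {m₁} ℕP.1+n≢n)))))) ⟩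
      d₀ * (γ * (1# + c * 0#)) + d₁ * (ν * Q m₁) ≈⟨ solve 6 (λ a b g c n q → a :* (g :* (:1 :+ c :* :0)) :+ b :* (n :* q) := a :* g :+ (b :* n) :* q) refl d₀ d₁ γ c ν (Q m₁) ⟩
      d₀ * γ + (d₁ * ν) * Q m₁                 ∎

    at-m : c₀ ≈ (d₀ * γ) * c
    at-m = begin
      c₀                                       ≈⟨ solve 3 (λ a b u → a := a :* :1 :+ b :* (u :* :0)) refl c₀ c₁ μ ⟩
      c₀ * 1# + c₁ * (μ * 0#)                  ≈⟨ +-cong (*-congˡ (reflexive (δ-diag m))) (*-congˡ (*-congˡ Pₘ≈0)) ⟨
      c₀ * δ m m + c₁ * (μ * P m)              ≈⟨ agree m (s≤s z≤n) ℕP.≤-refl ⟩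
      d₀ * (γ * (δ m₁ m + c * δ m m)) + d₁ * (ν * Q m)
        ≈⟨ +-cong (*-congˡ (*-congˡ (+-cong (reflexive (δ-off {m₁} {m} (ℕP.1+n≢n ∘ ≡.sym))) (*-congˡ (reflexive (δ-diag m))))))
                  (*-congˡ (*-congˡ Qₘ≈0)) ⟩
      d₀ * (γ * (0# + c * 1#)) + d₁ * (ν * 0#) ≈⟨ solve 5 (λ a b g c n → a :* (g :* (:0 :+ c :* :1)) :+ b :* (n :* :0) := (a :* g) :* c) refl d₀ d₁ γ c ν ⟩
      (d₀ * γ) * c                             ∎

  module Frame (M : ℕ) (x : ℕ → Vect (suc M)) (gp : GeneralPosition M x) where

    basis : Fin (suc M) → Vect (suc M)
    basis i = x (toℕ i)

    X : (ℕ → Carrier) → Vect (suc M)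
    X α = lincomb (λ i → α (toℕ i)) basis

    X-cong : ∀ {α β} → (∀ u → u ≤ M → α u ≈ β u) → ∀ t → X α t ≈ X β t
    X-cong α≈β = lincomb-cong basis (λ i → α≈β (toℕ i) (toℕ≤pred[n] i))

    X-+ : ∀ α β t → X (λ u → α u + β u) t ≈ X α t + X β t
    X-+ α β = lincomb-+ basis (λ i → α (toℕ i)) (λ i → β (toℕ i))

    X-* : ∀ a α t → X (λ u → a * α u) t ≈ a * X α t
    X-* a α = lincomb-* basis a (λ i → α (toℕ i))

    X-δ : ∀ {i} → i ≤ M → ∀ t → X (δ i) t ≈ x i t
    X-δ {i} i≤M t = begin
      X (δ i) t               ≈⟨ lincomb-single basis _ j (λ k k≢j → reflexive (δ-off (λ i≡k → k≢j (toℕ-injective (≡.trans (≡.sym i≡k) (≡.sym toℕj≡i)))))) t ⟩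
      δ i (toℕ j) * x (toℕ j) t ≡⟨ ≡.cong (λ k → δ i k * x k t) toℕj≡i ⟩
      δ i i * x i t           ≈⟨ trans (*-congʳ (reflexive (δ-diag i))) (*-identityˡ (x i t)) ⟩
      x i t                   ∎
      where
      j = fromℕ< (s≤s i≤M)
      toℕj≡i = toℕ-fromℕ< (s≤s i≤M)

    X-sum : ∀ {s} (q : Fin s → Carrier) (H : Fin s → ℕ → Carrier) t →
            sumFin (λ j → q j * X (H j) t) ≈ X (λ u → sumFin (λ j → q j * H j u)) t
    X-sum q H = lincomb-sum basis q (λ j i → H j (toℕ i))

    X-injective : ∀ α β → (∀ t → X α t ≈ X β t) → ∀ u → u ≤ M → α u ≈ β u
    X-injective α β Xα≈Xβ u u≤M = x∙y⁻¹≈ε⇒x≈y (α u) (β u)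
      (≡.subst (λ k → α k - β k ≈ 0#) (toℕ-fromℕ< (s≤s u≤M)) (gp (λ i → α (toℕ i) - β (toℕ i)) difference≈0 (fromℕ< (s≤s u≤M))))
      where
      difference≈0 : ∀ t → lincomb (λ i → α (toℕ i) - β (toℕ i)) basis t ≈ 0#
      difference≈0 t = trans (lincomb-- basis (λ i → α (toℕ i)) (λ i → β (toℕ i)) t) (trans (+-congʳ (Xα≈Xβ t)) (-‿inverseʳ (X β t)))

    X-inSpan-π : ∀ {r} (α : ℕ → Carrier) → suc r ≤ M → α 0 ≈ 0# →
                 (∀ u → suc (suc r) ≤ u → α u ≈ 0#) → InSpan (πsp x (suc r)) (X α)
    X-inSpan-π {r} α r<M α₀≈0 α≈0 = (λ j → α (suc (toℕ j))) , λ t → begin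
      α 0 * x 0 t + sumFin {M} (λ i → g (toℕ i) t)   ≈⟨ +-cong (trans (*-congʳ α₀≈0) (zeroˡ (x 0 t)))
                                                                 (sumFin-truncate (λ u → g u t) r<M (λ u r<u → trans (*-congʳ (α≈0 (suc u) (s≤s r<u))) (zeroˡ _))) ⟩
      0# + sumFin {suc r} (λ i → g (toℕ i) t)        ≈⟨ +-identityˡ _ ⟩
      lincomb (λ j → α (suc (toℕ j))) (πsp x (suc r)) t ∎
      where
      g : ℕ → Fin (suc M) → Carrier
      g u t = α (suc u) * x (suc u) t

    lineCoords : ∀ {A B : ℕ → Carrier} {u w v : Vect (suc M)} →
                 (∀ t → u t ≈ X A t) → (∀ t → w t ≈ X B t) → InSpan ⟨ u , w ⟩ v →
                 Σ Carrier λ c₀ → Σ Carrier λ c₁ → ∀ t → v t ≈ X (λ i → c₀ * A i + c₁ * B i) t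
    lineCoords {A} {B} {u} {w} {v} u≈ w≈ (cs , v≈) = cs zero , cs (suc zero) , λ t → begin
      v t                                        ≈⟨ v≈ t ⟩
      cs zero * u t + (cs (suc zero) * w t + 0#) ≈⟨ +-cong (*-congˡ (u≈ t)) (trans (+-identityʳ _) (*-congˡ (w≈ t))) ⟩
      cs zero * X A t + cs (suc zero) * X B t    ≈⟨ +-cong (X-* _ A t) (X-* _ B t) ⟨
      X (λ i → cs zero * A i) t + X (λ i → cs (suc zero) * B i) t ≈⟨ X-+ (λ i → cs zero * A i) (λ i → cs (suc zero) * B i) t ⟨
      X (λ i → cs zero * A i + cs (suc zero) * B i) t ∎

    -- A point v on both lines x_{s+3} ⊕ p
    -- and y ⊕ q is a multiple of X(P + t δ_{s+3}), t = c (P_{s+2} − Q_{s+2}):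
    -- writing v in coordinates along either line and comparing them
    -- (general position) fixes its coefficient along x_{s+3}.
    meet : ∀ s → 3 ℕ.+ s ≤ M → (P Q : ℕ → Carrier) →
           P 1 ≈ 1# → Q 1 ≈ 1# → P (3 ℕ.+ s) ≈ 0# → Q (3 ℕ.+ s) ≈ 0# →
           ∀ {μ ν γ c} {p q y v : Vect (suc M)} →
           (∀ t → p t ≈ μ * X P t) → (∀ t → q t ≈ ν * X Q t) →
           (∀ t → y t ≈ γ * (x (2 ℕ.+ s) t + c * x (3 ℕ.+ s) t)) →
           InSpan ⟨ x (3 ℕ.+ s) , p ⟩ v → InSpan ⟨ y , q ⟩ v →
           Σ Carrier λ λ₀ → ∀ t →
             v t ≈ λ₀ * X (λ u → P u + (c * (P (2 ℕ.+ s) - Q (2 ℕ.+ s))) * δ (3 ℕ.+ s) u) t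
    meet s m≤M P Q P₁≈1 Q₁≈1 Pₘ≈0 Qₘ≈0 {μ} {ν} {γ} {c} {p} {q} {y} {v} p≈ q≈ y≈ v∈xp v∈yq = λ₀ , v≈
      where
      m  = 3 ℕ.+ s
      m₁ = 2 ℕ.+ s
      t₀ = c * (P m₁ - Q m₁)

      y-coords : ∀ t → y t ≈ X (λ u → γ * (δ m₁ u + c * δ m u)) t
      y-coords t = begin
        y t                                          ≈⟨ y≈ t ⟩
        γ * (x m₁ t + c * x m t)                     ≈⟨ *-congˡ (+-cong (X-δ (ℕP.≤-trans (ℕP.n≤1+n m₁) m≤M) t) (*-congˡ (X-δ m≤M t))) ⟨
        γ * (X (δ m₁) t + c * X (δ m) t)             ≈⟨ *-congˡ (+-congˡ (X-* c (δ m) t)) ⟨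
        γ * (X (δ m₁) t + X (λ u → c * δ m u) t)     ≈⟨ *-congˡ (X-+ (δ m₁) (λ u → c * δ m u) t) ⟨
        γ * X (λ u → δ m₁ u + c * δ m u) t           ≈⟨ X-* γ (λ u → δ m₁ u + c * δ m u) t ⟨
        X (λ u → γ * (δ m₁ u + c * δ m u)) t         ∎

      first = lineCoords {A = δ m} {B = λ u → μ * P u}
                (λ t → sym (X-δ m≤M t)) (λ t → trans (p≈ t) (sym (X-* μ P t))) v∈xp
      second = lineCoords {A = λ u → γ * (δ m₁ u + c * δ m u)} {B = λ u → ν * Q u}
                 y-coords (λ t → trans (q≈ t) (sym (X-* ν Q t))) v∈yq
      c₀ = proj₁ first
      c₁ = proj₁ (proj₂ first)
      d₀ = proj₁ second
      d₁ = proj₁ (proj₂ second)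
      λ₀ = c₁ * μ

      coordinates-agree : ∀ u → u ≤ M →
        c₀ * δ m u + c₁ * (μ * P u) ≈ d₀ * (γ * (δ m₁ u + c * δ m u)) + d₁ * (ν * Q u)
      coordinates-agree = X-injective (λ u → c₀ * δ m u + c₁ * (μ * P u))
        (λ u → d₀ * (γ * (δ m₁ u + c * δ m u)) + d₁ * (ν * Q u))
        (λ t → trans (sym (proj₂ (proj₂ first) t)) (proj₂ (proj₂ second) t))

      c₀≈λ₀t₀ : c₀ ≈ λ₀ * t₀
      c₀≈λ₀t₀ = coefficient-at-meet s P Q c₀ c₁ μ d₀ d₁ ν γ c P₁≈1 Q₁≈1 Pₘ≈0 Qₘ≈0
        (λ u _ u≤m → coordinates-agree u (ℕP.≤-trans u≤m m≤M))

      v≈ : ∀ t → v t ≈ λ₀ * X (λ u → P u + t₀ * δ m u) t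
      v≈ t = begin
        v t                                            ≈⟨ proj₂ (proj₂ first) t ⟩
        X (λ u → c₀ * δ m u + c₁ * (μ * P u)) t        ≈⟨ X-cong (λ u _ → coefficient u) t ⟩
        X (λ u → λ₀ * (P u + t₀ * δ m u)) t            ≈⟨ X-* λ₀ (λ u → P u + t₀ * δ m u) t ⟩
        λ₀ * X (λ u → P u + t₀ * δ m u) t              ∎
        where
        coefficient : ∀ u → c₀ * δ m u + c₁ * (μ * P u) ≈ λ₀ * (P u + t₀ * δ m u)
        coefficient u = trans (+-congʳ (*-congʳ c₀≈λ₀t₀))
          (solve 5 (λ a b t p d → (a :* b :* t) :* d :+ a :* (b :* p) := a :* b :* (p :+ t :* d)) refl c₁ μ t₀ (P u) (δ m u))

    X-coords-one : ∀ slope → 2 ≤ M → ∀ q t →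
                   x 1 t + q 0 * x 2 t ≈ X (Sequences.coords slope 1 q) t
    X-coords-one slope 2≤M q t = begin
      x 1 t + q 0 * x 2 t                       ≈⟨ +-cong (X-δ (ℕP.≤-trans (s≤s z≤n) 2≤M) t) (*-congˡ (X-δ 2≤M t)) ⟨
      X (δ 1) t + q 0 * X (δ 2) t               ≈⟨ +-congˡ (X-* (q 0) (δ 2) t) ⟨
      X (δ 1) t + X (λ u → q 0 * δ 2 u) t       ≈⟨ X-+ (δ 1) (λ u → q 0 * δ 2 u) t ⟨
      X (λ u → δ 1 u + q 0 * δ 2 u) t           ≈⟨ X-cong (λ u _ → coordinate u) t ⟩
      X (coords 1 q) t                          ∎
      where
      open Sequences slope
      coordinate : ∀ u → δ 1 u + q 0 * δ 2 u ≈ coords 1 q u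
      coordinate zero                = solve 1 (λ r → :0 :+ r :* :0 := :0 :+ :0) refl (q 0)
      coordinate (suc zero)          = solve 1 (λ r → :1 :+ r :* :0 := :0 :+ :1) refl (q 0)
      coordinate (suc (suc zero))    = solve 1 (λ r → :0 :+ r :* :1 := :1 :* (r :- :0) :+ :0) refl (q 0)
      coordinate (suc (suc (suc s))) = solve 2 (λ r d → :0 :+ r :* :0 := :0 :* d :+ :0) refl (q 0) (q (suc s) - q s)

    module Recursion (slope : ℕ → Carrier) {k} (a : Fin k → Carrier)
      (y : ℕ → Vect (suc M)) (p : List (Fin k) → Vect (suc M))
      (y-on-line : ∀ s → 3 ℕ.+ s ≤ M →
        Σ Carrier λ γ → ∀ t → y (3 ℕ.+ s) t ≈ γ * (x (2 ℕ.+ s) t + slope (3 ℕ.+ s) * x (3 ℕ.+ s) t))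
      (p-singleton : ∀ i → Σ Carrier λ A → ∀ t → p (i ∷ []) t ≈ A * (x 1 t + a i * x 2 t))
      (p-meet : ∀ I b a' → Unique (I ++ b ∷ a' ∷ []) → length I ℕ.+ 3 ≤ M →
        InSpan ⟨ x (length I ℕ.+ 3) , p (I ++ b ∷ []) ⟩ (p (I ++ b ∷ a' ∷ [])) ×
        InSpan ⟨ y (length I ℕ.+ 3) , p (I ++ a' ∷ []) ⟩ (p (I ++ b ∷ a' ∷ [])))
      where
      open Sequences slope
      open Labelling a

      Represented : List (Fin k) → Set (c ⊔ ℓ)
      Represented J = Σ Carrier λ μ → ∀ t → p J t ≈ μ * X (pointCoords J) t

      extend : ∀ I b a' → Unique (I ++ b ∷ a' ∷ []) → 3 ℕ.+ length I ≤ M →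
               Represented (I ++ b ∷ []) → Represented (I ++ a' ∷ []) → Represented (I ++ b ∷ a' ∷ [])
      extend I b a' uniq m≤M (μ , pb≈) (ν , pa≈) = λ₀ , λ t →
        trans (pJ≈ t) (*-congˡ (X-cong (λ u _ → sym (pointCoords-step I b a' u)) t))
        where
        L = length I
        lines = p-meet I b a' uniq (≡.subst (_≤ M) (ℕP.+-comm 3 L) m≤M)
        -- the hypotheses index the lines by |I| + 3,  meet  by 3 + |I|
        reindex : ∀ {v : ℕ → Vect (suc M)} {w : Vect (suc M)} →
                  InSpan ⟨ v (L ℕ.+ 3) , w ⟩ (p (I ++ b ∷ a' ∷ [])) → InSpan ⟨ v (3 ℕ.+ L) , w ⟩ (p (I ++ b ∷ a' ∷ []))
        reindex {v} {w} = ≡.subst (λ m → InSpan ⟨ v m , w ⟩ (p (I ++ b ∷ a' ∷ []))) (ℕP.+-comm L 3)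
        one : ∀ z → pointCoords (I ++ z ∷ []) 1 ≈ 1#
        one z = coords-one (length (I ++ z ∷ [])) (labels (I ++ z ∷ []))
        beyond : ∀ z → pointCoords (I ++ z ∷ []) (3 ℕ.+ L) ≈ 0#
        beyond z = coords-beyond (length (I ++ z ∷ [])) (labels (I ++ z ∷ [])) (3 ℕ.+ L)
                     (ℕP.≤-reflexive (≡.cong (2 ℕ.+_) (length-snoc I z)))
        meeting = meet L m≤M (pointCoords (I ++ b ∷ [])) (pointCoords (I ++ a' ∷ []))
                    (one b) (one a') (beyond b) (beyond a') pb≈ pa≈ (proj₂ (y-on-line L m≤M))
                    (reindex {x} (proj₁ lines)) (reindex {y} (proj₂ lines))
        λ₀ = proj₁ meeting
        pJ≈ = proj₂ meeting

      represented : ∀ j J → Unique J → length J ≡ suc j → 2 ℕ.+ j ≤ M → Represented J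
      represented zero    (i ∷ []) _    _   2≤M   = proj₁ (p-singleton i) , λ t →
        trans (proj₂ (p-singleton i) t) (*-congˡ (X-coords-one slope 2≤M (labels (i ∷ [])) t))
      represented (suc j) J        uniq len 3+j≤M with unsnoc₂ J len
      ... | I , b , a' , ≡.refl , ≡.refl =
        extend I b a' uniq 3+j≤M
          (represented j (I ++ b ∷ [])  (unique-init I uniq)       (length-snoc I b)  (ℕP.≤-trans (ℕP.n≤1+n _) 3+j≤M))
          (represented j (I ++ a' ∷ []) (unique-remove I (a' ∷ []) uniq) (length-snoc I a') (ℕP.≤-trans (ℕP.n≤1+n _) 3+j≤M))

    -- For n ≥ 1 the basis  e_0,…,e_{n-1}, e_n  of π_{n+1} consists
    -- of the coordinate vectors  steps n (δ t)  of the unit label sequences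
    -- (t < n) and of x_1; by linearity of  steps, the grid point with
    -- coordinates b_0,…,b_{n-1} is X(coords n b).
    module Grid (slope : ℕ → Carrier) (n : ℕ) where
      open Sequences slope

      gridCoords : ℕ → ℕ → Carrier
      gridCoords t = select t n (steps n (δ t)) (δ 1)

      e : Fin (suc n) → Vect (suc M)
      e i = X (gridCoords (toℕ i))

      e-init : ∀ i → e (inject₁ i) ≡ X (steps n (δ (toℕ i)))
      e-init i rewrite toℕ-inject₁ i = ≡.cong X (select-< (steps n (δ (toℕ i))) (δ 1) (toℕ<n i))

      e-last : e (fromℕ n) ≡ X (δ 1)
      e-last rewrite toℕ-fromℕ n = ≡.cong X (select-≥ (steps n (δ n)) (δ 1) (ℕP.≤-refl {n}))

      spread : (Fin n → Carrier) → ℕ → Carrier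
      spread b s = sumFin (λ i → b i * δ (toℕ i) s)

      spread-toℕ : ∀ b j → spread b (toℕ j) ≈ b j
      spread-toℕ b j = begin
        spread b (toℕ j)             ≈⟨ sumFin-single (λ i → b i * δ (toℕ i) (toℕ j)) j
                                          (λ i i≢j → trans (*-congˡ (reflexive (δ-off (i≢j ∘ toℕ-injective)))) (zeroʳ (b i))) ⟩
        b j * δ (toℕ j) (toℕ j)      ≈⟨ *-congˡ (reflexive (δ-diag (toℕ j))) ⟩
        b j * 1#                     ≈⟨ *-identityʳ (b j) ⟩
        b j                          ∎

      combination : ∀ b L t → sumFin (λ i → b i * e (inject₁ i) t) + L * e (fromℕ n) t
                              ≈ X (λ u → steps n (spread b) u + L * δ 1 u) t
      combination b L t = begin
        sumFin (λ i → b i * e (inject₁ i) t) + L * e (fromℕ n) t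
          ≈⟨ +-cong (sumFin-cong (λ i → *-congˡ (reflexive (≡.cong-app (e-init i) t))))
                    (*-congˡ (reflexive (≡.cong-app e-last t))) ⟩
        sumFin (λ i → b i * X (steps n (δ (toℕ i))) t) + L * X (δ 1) t
          ≈⟨ +-cong (X-sum b (λ i → steps n (δ (toℕ i))) t) (sym (X-* L (δ 1) t)) ⟩
        X (λ u → sumFin (λ i → b i * steps n (δ (toℕ i)) u)) t + X (λ u → L * δ 1 u) t
          ≈⟨ +-congʳ (X-cong (λ u _ → steps-linear n b (λ i → δ (toℕ i)) u) t) ⟩
        X (steps n (spread b)) t + X (λ u → L * δ 1 u) t
          ≈⟨ X-+ (steps n (spread b)) (λ u → L * δ 1 u) t ⟨
        X (λ u → steps n (spread b) u + L * δ 1 u) t ∎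

      e-independent : suc n ≤ M → (∀ s → s < n → ¬ (weight s ≈ 0#)) → LinIndep e
      e-independent n<M weight≉0 cs lc≈0 = vanish
        where
        b : Fin n → Carrier
        b j = cs (inject₁ j)
        L = cs (fromℕ n)
        coefficients≈0 : ∀ u → u ≤ M → steps n (spread b) u + L * δ 1 u ≈ 0#
        coefficients≈0 = X-injective _ (λ _ → 0#) λ t → begin
          X (λ u → steps n (spread b) u + L * δ 1 u) t       ≈⟨ combination b L t ⟨
          sumFin (λ j → b j * e (inject₁ j) t) + L * e (fromℕ n) t ≈⟨ sumFin-init-last (λ i → cs i * e i t) ⟨
          lincomb cs e t                                      ≈⟨ lc≈0 t ⟩
          0#                                                  ≈⟨ lincomb-zero basis (λ _ → 0#) (λ _ → refl) t ⟨
          X (λ _ → 0#) t                                      ∎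
        L≈0 : L ≈ 0#
        L≈0 = trans (solve 1 (λ l → l := :0 :+ l :* :1) refl L) (coefficients≈0 1 (ℕP.≤-trans (s≤s z≤n) n<M))
        spread≈0 : ∀ s → s < n → spread b s ≈ 0#
        spread≈0 = steps-injective n (spread b) weight≉0 λ s s<n →
          trans (solve 2 (λ d l → d := d :+ l :* :0) refl (steps n (spread b) (2 ℕ.+ s)) L)
                (coefficients≈0 (2 ℕ.+ s) (ℕP.≤-trans (s≤s s<n) n<M))
        vanish : ∀ i → cs i ≈ 0#
        vanish i with n ℕ.≟ toℕ i
        ... | yes n≡i = ≡.subst (λ j → cs j ≈ 0#) (toℕ-injective (≡.trans (toℕ-fromℕ n) n≡i)) L≈0
        ... | no n≢i  = ≡.subst (λ j → cs j ≈ 0#) (inject₁-lower₁ i n≢i)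
                          (trans (sym (spread-toℕ b j)) (spread≈0 (toℕ j) (toℕ<n j)))
          where j = lower₁ i n≢i

      e-inSpan : suc n ≤ M → ∀ i → InSpan (πsp x (suc n)) (e i)
      e-inSpan n<M i = X-inSpan-π (gridCoords (toℕ i)) n<M (proj₁ supported) (proj₂ supported)
        where
        Supported : (ℕ → Carrier) → Set ℓ
        Supported f = f 0 ≈ 0# × (∀ u → 2 ℕ.+ n ≤ u → f u ≈ 0#)
        δ₁-beyond : ∀ u → 2 ℕ.+ n ≤ u → δ 1 u ≈ 0#
        δ₁-beyond (suc zero)    (s≤s ())
        δ₁-beyond (suc (suc _)) _ = refl
        supported = select-preserves Supported (refl , steps-beyond n (δ (toℕ i))) (refl , δ₁-beyond) (toℕ i) n

      gridVec-labels : ∀ {k} (a : Fin k → Carrier) J (len : length J ≡ n) t →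
        gridVec e (λ i → a (lookup J (Fin.cast (≡.sym len) i))) t ≈ X (Labelling.pointCoords a J) t
      gridVec-labels a J len t = begin
        sumFin (λ i → b i * e (inject₁ i) t) + e (fromℕ n) t       ≈⟨ +-congˡ (*-identityˡ _) ⟨
        sumFin (λ i → b i * e (inject₁ i) t) + 1# * e (fromℕ n) t  ≈⟨ combination b 1# t ⟩
        X (λ u → steps n (spread b) u + 1# * δ 1 u) t              ≈⟨ X-cong (λ u _ → +-cong (steps-local n spread≈labels u) (*-identityˡ (δ 1 u))) t ⟩
        X (λ u → steps n (labels J) u + δ 1 u) t                   ≡⟨ ≡.cong (λ m → X (coords m (labels J)) t) (≡.sym len) ⟩
        X (pointCoords J) t                                        ∎
        where
        open Labelling a
        b : Fin n → Carrier
        b i = a (lookup J (Fin.cast (≡.sym len) i))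
        spread≈labels : ∀ s → s < n → spread b s ≈ labels J s
        spread≈labels s s<n = begin
          spread b s                 ≡⟨ ≡.cong (spread b) (toℕ-fromℕ< s<n) ⟨
          spread b (toℕ j)           ≈⟨ spread-toℕ b j ⟩
          b j                        ≡⟨ labels-lookup J (Fin.cast (≡.sym len) j) ⟨
          labels J (toℕ (Fin.cast (≡.sym len) j)) ≡⟨ ≡.cong (labels J) (≡.trans (toℕ-cast (≡.sym len) j) (toℕ-fromℕ< s<n)) ⟩
          labels J s                 ∎
          where j = fromℕ< s<n

    OnLineWithSlope : Vect (suc M) → ℕ → Carrier → Set (c ⊔ ℓ)
    OnLineWithSlope v m r = ¬ (r ≈ 0#) × Σ Carrier λ γ → ∀ t → v t ≈ γ * (x (m ℕ.∸ 1) t + r * x m t)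

    slopes : (y : ℕ → Vect (suc M)) →
      (∀ m → 3 ≤ m → m ≤ M → InSpan ⟨ x (m ℕ.∸ 1) , x m ⟩ (y m) ×
                             ¬ SamePoint (y m) (x (m ℕ.∸ 1)) × ¬ SamePoint (y m) (x m)) →
      Σ (ℕ → Carrier) λ slope → ∀ m → 3 ≤ m × m ≤ M → OnLineWithSlope (y m) m (slope m)
    slopes y y-data = choose {Q = λ m → OnLineWithSlope (y m) m} (λ m → 3 ℕ.≤? m ×-dec m ℕ.≤? M) 1# witness
      where
      witness : ∀ m → 3 ≤ m × m ≤ M → Σ Carrier (OnLineWithSlope (y m) m)
      witness m (3≤m , m≤M) = normalForm (y-data m 3≤m m≤M)
        where
        normalForm : InSpan ⟨ x (m ℕ.∸ 1) , x m ⟩ (y m) × ¬ SamePoint (y m) (x (m ℕ.∸ 1)) × ¬ SamePoint (y m) (x m) →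
                     Σ Carrier (OnLineWithSlope (y m) m)
        normalForm (y∈ , y≉xₘ₋₁ , y≉xₘ) =
          r , ratio-nonzero {u = x (m ℕ.∸ 1)} {w = x m} {v = y m} y≈ y≉xₘ₋₁ , γ , y≈
          where
          line = onLine {u = x (m ℕ.∸ 1)} {w = x m} {v = y m} y∈ y≉xₘ
          γ = proj₁ line
          r = proj₁ (proj₂ line)
          y≈ : ∀ t → y m t ≈ γ * (x (m ℕ.∸ 1) t + r * x m t)
          y≈ = proj₂ (proj₂ (proj₂ line))

    Labelled : ∀ {k} → (Fin k → Vect (suc M)) → (Fin k → Carrier) → Set (c ⊔ ℓ)
    Labelled p₁ a = ∀ i → Σ Carrier λ A → ¬ (A ≈ 0#) × (∀ t → p₁ i t ≈ A * (x 1 t + a i * x 2 t))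

    labelling : ∀ {k} (p₁ : Fin k → Vect (suc M)) →
      (∀ i → InSpan (πsp x 2) (p₁ i) × ¬ SamePoint (p₁ i) (x 2)) → Σ (Fin k → Carrier) (Labelled p₁)
    labelling p₁ p₁-data = (λ i → proj₁ (proj₂ (line i))) , λ i →
      proj₁ (line i) , proj₁ (proj₂ (proj₂ (line i))) , proj₂ (proj₂ (proj₂ (line i)))
      where
      line : ∀ i → Σ Carrier λ A → Σ Carrier λ r → ¬ (A ≈ 0#) × (∀ t → p₁ i t ≈ A * (x 1 t + r * x 2 t))
      line i = onLine {u = x 1} {w = x 2} {v = p₁ i} (proj₁ (p₁-data i)) (proj₂ (p₁-data i))

    labels-injective : ∀ {k} {p₁ : Fin k → Vect (suc M)} {a : Fin k → Carrier} → Labelled p₁ a →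
      (∀ i j → i ≢ j → ¬ SamePoint (p₁ i) (p₁ j)) → ∀ i j → a i ≈ a j → i ≡ j
    labels-injective normalForm distinct i j aᵢ≈aⱼ = decidable-stable (i Fin.≟ j) λ i≢j →
      distinct i j i≢j (sameRatio⇒samePoint (proj₂ (proj₂ (normalForm i))) (proj₂ (proj₂ (normalForm j)))
                                            (proj₁ (proj₂ (normalForm j))) aᵢ≈aⱼ)

    pointsInGrid : ∀ {k} n → suc n ≤ M → (slope : ℕ → Carrier) → (∀ m → 3 ≤ m × m ≤ M → ¬ (slope m ≈ 0#)) →
      (a : Fin k → Carrier) → (∀ i j → a i ≈ a j → i ≡ j) → (p : List (Fin k) → Vect (suc M)) →
      (∀ J → Unique J → length J ≡ n → Σ Carrier λ μ → ∀ t → p J t ≈ μ * X (Sequences.Labelling.pointCoords slope a J) t) →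
      InGrid k (πsp x (suc n)) (λ v → Σ (List (Fin k)) λ J → Unique J × length J ≡ n × v ≡ p J)
    pointsInGrid {k} n n<M slope slope≉0 a a-injective p represented =
      e , e-independent n<M weight≉0 , e-inSpan n<M , (λ _ → a) , (λ _ → a-injective) , onGrid
      where
      open Sequences slope
      open Grid slope n
      weight≉0 : ∀ s → s < n → ¬ (weight s ≈ 0#)
      weight≉0 s s<n = weight-nonzero s λ t t<s →
        slope≉0 (3 ℕ.+ t) (s≤s (s≤s (s≤s z≤n)) , ℕP.≤-trans (s≤s (s≤s t<s)) (ℕP.≤-trans (s≤s s<n) n<M))
      onGrid : ∀ v → (Σ (List (Fin k)) λ J → Unique J × length J ≡ n × v ≡ p J) →
               Σ (Fin n → Fin k) λ s → SamePoint v (gridVec e (λ i → a (s i)))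
      onGrid v (J , uniq , len , ≡.refl) = (λ i → lookup J (Fin.cast (≡.sym len) i)) , (λ _ → μ) , λ t →
        trans (pJ≈ t) (trans (*-congˡ (sym (gridVec-labels a J len t))) (sym (+-identityʳ _)))
        where
        μ = proj₁ (represented J uniq len)
        pJ≈ = proj₂ (represented J uniq len)

open import Defs
-- natural-number addition is opened only here: above, _+_ is the field's
open import Data.Nat using (_+_; _∸_)

lemma2p2 : ∀ {c ℓ} (K : Field c ℓ) → let open LinAlg K in
  (n M : ℕ) → 1 ≤ n → n + 1 ≤ M →
  -- x_0,…,x_M in general position in PG_M(K)
  (x : ℕ → Vect (suc M)) → GeneralPosition M x →
  -- y_i (3 ≤ i ≤ M) on the line x_{i-1} ⊕ x_i, distinct from x_{i-1}, x_i
  (y : ℕ → Vect (suc M)) →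
  (∀ i → 3 ≤ i → i ≤ M →
    IsPoint (y i) × InSpan ⟨ x (i ∸ 1) , x i ⟩ (y i) ×
    ¬ SamePoint (y i) (x (i ∸ 1)) × ¬ SamePoint (y i) (x i)) →
  -- the |L| = k lines ℓ_(i) = u_i ⊕ w_i of the plane Σ_2, none equal to π_2
  (k : ℕ) (u w : Fin k → Vect (suc M)) →
  (∀ i → InSpan (Σsp x 2) (u i) × InSpan (Σsp x 2) (w i) ×
         LinIndep ⟨ u i , w i ⟩ × ¬ SameSpan ⟨ u i , w i ⟩ (πsp x 2)) →
  -- the points p_J, J an ordered subset (duplicate-free list) of {1,…,k}
  (p : List (Fin k) → Vect (suc M)) →
  -- p_(i) = ℓ_(i) ∩ π_2, pairwise distinct, different from x_2
  (∀ i → IsPoint (p (i ∷ [])) × InSpan ⟨ u i , w i ⟩ (p (i ∷ [])) ×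
         InSpan (πsp x 2) (p (i ∷ [])) × ¬ SamePoint (p (i ∷ [])) (x 2)) →
  (∀ i j → i ≢ j → ¬ SamePoint (p (i ∷ [])) (p (j ∷ []))) →
  -- for J = (…,b,a) with 2 ≤ |J| ≤ M-1:
  -- p_J = (x_{|J|+1} ⊕ p_{J∖{a}}) ∩ (y_{|J|+1} ⊕ p_{J∖{b}})  (two distinct lines)
  (∀ (I : List (Fin k)) (b a : Fin k) → Unique (I ++ b ∷ a ∷ []) →
    length I + 3 ≤ M →
    IsPoint (p (I ++ b ∷ a ∷ [])) ×
    InSpan ⟨ x (length I + 3) , p (I ++ b ∷ []) ⟩ (p (I ++ b ∷ a ∷ [])) ×
    InSpan ⟨ y (length I + 3) , p (I ++ a ∷ []) ⟩ (p (I ++ b ∷ a ∷ [])) ×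
    ¬ SameSpan ⟨ x (length I + 3) , p (I ++ b ∷ []) ⟩
               ⟨ y (length I + 3) , p (I ++ a ∷ []) ⟩) →
  -- conclusion: { p_J : |J| = n } lies in a k^n grid of π_{n+1}
  InGrid k (πsp x (suc n))
    (λ v → Σ (List (Fin k)) λ J → Unique J × length J ≡ n × v ≡ p J)

lemma2p2 K (suc n) M (s≤s z≤n) n+1≤M x gp y y-data k _ _ _ p p-data p-distinct p-meet =
  pointsInGrid (suc n) n+2≤M slope slope≉0 a a-injective p
    (λ J uniq len → represented n J uniq len n+2≤M)
  where
  open Field K using (Carrier; _≈_; 0#)
  open Geometry K
  open Frame M x gp
  n+2≤M : 2 + n ≤ M
  n+2≤M = ≡.subst (_≤ M) (ℕP.+-comm (suc n) 1) n+1≤M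
  slope-data : Σ (ℕ → Carrier) λ slope → ∀ m → 3 ≤ m × m ≤ M → OnLineWithSlope (y m) m (slope m)
  slope-data = slopes y (λ m 3≤m m≤M → proj₂ (y-data m 3≤m m≤M))
  slope : ℕ → Carrier
  slope = proj₁ slope-data
  slope≉0 : ∀ m → 3 ≤ m × m ≤ M → ¬ (slope m ≈ 0#)
  slope≉0 m bounds = proj₁ (proj₂ slope-data m bounds)
  label-data : Σ (Fin k → Carrier) (Labelled (λ i → p (i ∷ [])))
  label-data = labelling (λ i → p (i ∷ [])) (λ i → proj₁ (proj₂ (proj₂ (p-data i))) , proj₂ (proj₂ (proj₂ (p-data i))))
  a : Fin k → Carrier
  a = proj₁ label-data
  a-injective : ∀ i j → a i ≈ a j → i ≡ j
  a-injective = labels-injective (proj₂ label-data) p-distinct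
  open Recursion slope a y p
    (λ s 3+s≤M → proj₂ (proj₂ slope-data (3 + s) (s≤s (s≤s (s≤s z≤n)) , 3+s≤M)))
    (λ i → proj₁ (proj₂ label-data i) , proj₂ (proj₂ (proj₂ label-data i)))
    (λ I b a' uniq le → proj₁ (proj₂ (p-meet I b a' uniq le)) , proj₁ (proj₂ (proj₂ (p-meet I b a' uniq le))))
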